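{- There exists a simple directed temporal graph $\mathcal{G}=(V,E,\lambda)$ such that there is no directed temporal graph $\mathcal{H}$ on the vertex set $V$ (with arbitrary, possibly multiple, labels) whose non-strict reachability graph is isomorphic to the strict reachability graph of $\mathcal{G}$. In other words, some graph in the setting D \& strict \& simple has no reachability equivalent graph in the setting D \& non-strict.
   Context: A directed temporal graph is a triple $\mathcal{G}=(V,E,\lambda)$ with $V$ a finite vertex set, $E\subseteq\{(u,v)\in V\times V: u\ne v\}$ a set of arcs, and $\lambda\colon E\to 2^{\mathbb{N}}\setminus\{\emptyset\}$ assigning to each arc a nonempty finite set of time labels. $\mathcal{G}$ is simple if $|\lambda(e)|=1$ for all $e$. A temporal path from $u$ to $v$ is a sequence $(e_1,t_1),\dots,(e_k,t_k)$, $k\ge1$, with $t_i\in\lambda(e_i)$, such that $e_1,\dots,e_k$ form a directed path from $u$ to $v$ in $(V,E)$ (distinct vertices) and $t_1\le\dots\le t_k$; it is strict if $t_1<\dots<t_k$. The strict (resp. non-strict) reachability graph is the static directed graph on $V$ with an arc $(u,v)$, $u\ne v$, iff there is a strict (resp. arbitrary) temporal path from $u$ to $v$. The setting D \& strict \& simple consists of simple directed temporal graphs with strict reachability; D \& non-strict consists of all directed temporal graphs with non-strict reachability. Two temporal graphs on the same vertex set are reachability equivalent if their reachability graphs (each computed in its own setting) are isomorphic. -}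

module Defs where

open import Data.Nat using (ℕ; _<_; _≤_)
open import Data.Fin using (Fin)
open import Data.List using (List; []; _∷_; _++_; [_]; length)
open import Data.List.Membership.Propositional using (_∈_)
open import Data.List.Relation.Unary.Unique.Propositional using (Unique)
open import Data.Product using (Σ; ∃; _×_; _,_)
open import Relation.Binary.PropositionalEquality using (_≡_; _≢_)
open import Function.Bundles using (_↔_; Inverse; _⇔_)

-- A directed temporal graph on the vertex set V = Fin n.
-- labels u v is the (finite) set of time labels λ((u,v)), as a list;
-- the arc (u,v) is in E iff labels u v is nonempty.  No self loops.
record DTG (n : ℕ) : Set where
  field
    labels : Fin n → Fin n → List ℕ
    noLoops : ∀ u → labels u u ≡ []
open DTG public

-- Simple: every arc carries exactly one label (lists of length ≤ 1;
-- length 0 means "not an arc").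
Simple : ∀ {n} → DTG n → Set
Simple G = ∀ u v → length (labels G u v) ≤ 1

-- Temporal walks from u to v, listing the visited vertices (in order)
-- and remembering the time label of the last arc.  `ok t t'` is the
-- constraint between consecutive labels (_<_ strict, _≤_ non-strict).
data TWalk {n : ℕ} (G : DTG n) (ok : ℕ → ℕ → Set)
     : Fin n → Fin n → List (Fin n) → ℕ → Set where
  single : ∀ {u v t} → t ∈ labels G u v → TWalk G ok u v (u ∷ v ∷ []) t
  extend : ∀ {u w x vs t t'} → TWalk G ok u w vs t →
           t' ∈ labels G w x → ok t t' → TWalk G ok u x (vs ++ [ x ]) t'

TPath : ∀ {n} → DTG n → (ℕ → ℕ → Set) → Fin n → Fin n → Set
TPath {n} G ok u v =
  Σ (List (Fin n)) λ vs → Σ ℕ λ t → TWalk G ok u v vs t × Unique vs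

StrictReach : ∀ {n} → DTG n → Fin n → Fin n → Set
StrictReach G u v = u ≢ v × TPath G _<_ u v

NonStrictReach : ∀ {n} → DTG n → Fin n → Fin n → Set
NonStrictReach G u v = u ≢ v × TPath G _≤_ u v

Isomorphic : ∀ {n} → (Fin n → Fin n → Set) → (Fin n → Fin n → Set) → Set
Isomorphic {n} R S = Σ (Fin n ↔ Fin n) λ σ →
  ∀ u v → R u v ⇔ S (Inverse.to σ u) (Inverse.to σ v)

module Submission where

open import Defs
open import Data.Nat using (ℕ; _≤_; _<_; z≤n; s≤s)
open import Data.Nat.Properties using (≤-total; ≤-trans; <-irrefl)
open import Data.Fin using (Fin; zero; suc; _≟_)
open import Data.List using (List; []; [_])
open import Data.List.Relation.Unary.Any using (here)
open import Data.List.Relation.Unary.All using ([]; _∷_)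
open import Data.List.Relation.Unary.AllPairs using ([]; _∷_)
open import Data.List.Membership.Propositional using (_∈_)
open import Data.Product using (Σ; ∃; _×_; _,_; proj₁; proj₂)
open import Data.Sum using (inj₁; inj₂)
open import Function using (_∘_)
open import Function.Bundles using (Inverse; Injection; Equivalence; _⇔_; mk⇔)
open import Function.Definitions using (Injective)
open import Function.Properties.Inverse using (↔⇒↣)
open import Relation.Nullary using (¬_; yes; no)
open import Relation.Nullary.Negation using (contradiction)
open import Relation.Binary.PropositionalEquality using (_≡_; _≢_; refl; sym; cong; subst)
open Relation.Binary.PropositionalEquality.≡-Reasoning

-- The directed triangle with every arc labelled 1 strictly reaches exactly
-- along its arcs, so its strict reachability graph is a directed 3-cycle.
-- Suppose some H realised a directed 3-cycle a → b → c → a non-strictly.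
-- Since a reaches only b, the first arc of a path from a must end in b, so
-- H has arcs a → b, b → c, c → a with labels t₁, t₂, t₃.  These cannot
-- strictly decrease all the way round, so two consecutive arcs, say
-- a → b → c, satisfy t₁ ≤ t₂ and give a non-strict path from a to c.

module _ {n : ℕ} (H : DTG n) where

  arc-irreflexive : ∀ {u v t} → t ∈ labels H u v → u ≢ v
  arc-irreflexive {u} p refl with subst (_ ∈_) (noLoops H u) p
  ... | ()

  arc⇒reach : ∀ {ok u v t} → t ∈ labels H u v → u ≢ v × TPath H ok u v
  arc⇒reach p = u≢v , _ , _ , single p , (u≢v ∷ []) ∷ [] ∷ []
    where u≢v = arc-irreflexive p

  two-arcs⇒NonStrictReach : ∀ {a b c t₁ t₂} → a ≢ c →
    t₁ ∈ labels H a b → t₂ ∈ labels H b c → t₁ ≤ t₂ → NonStrictReach H a c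
  two-arcs⇒NonStrictReach a≢c p q t₁≤t₂ =
    a≢c , _ , _ , extend (single p) q t₁≤t₂ ,
    (arc-irreflexive p ∷ a≢c ∷ []) ∷ (arc-irreflexive q ∷ []) ∷ [] ∷ []

  first-arc : ∀ {ok u v vs t} → TWalk H ok u v vs t → ∃ λ w → ∃ λ t₀ → t₀ ∈ labels H u w
  first-arc (single p)     = _ , _ , p
  first-arc (extend w _ _) = first-arc w

  reach-sole-successor⇒arc : ∀ {ok u v} →
    (∀ {w} → u ≢ w × TPath H ok u w → w ≡ v) → TPath H ok u v → ∃ λ t → t ∈ labels H u v
  reach-sole-successor⇒arc sole (_ , _ , walk , _) with first-arc walk
  ... | w , t₀ , p = t₀ , subst (λ x → t₀ ∈ labels H _ x) (sole (arc⇒reach p)) p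

  constant-labels⇒strict-walk-is-arc : ∀ {k} → (∀ {u v t} → t ∈ labels H u v → t ≡ k) →
    ∀ {u v vs t} → TWalk H _<_ u v vs t → t ∈ labels H u v
  constant-labels⇒strict-walk-is-arc const (single p) = p
  constant-labels⇒strict-walk-is-arc const (extend walk p t<t')
    with const (constant-labels⇒strict-walk-is-arc const walk) | const p
  ... | refl | refl = contradiction t<t' (<-irrefl refl)

next : Fin 3 → Fin 3
next zero             = suc zero
next (suc zero)       = suc (suc zero)
next (suc (suc zero)) = zero

next-no-fixpoint : ∀ x → next x ≢ x
next-no-fixpoint zero             ()
next-no-fixpoint (suc zero)       ()
next-no-fixpoint (suc (suc zero)) ()

next²-no-fixpoint : ∀ x → next (next x) ≢ x
next²-no-fixpoint zero             ()
next²-no-fixpoint (suc zero)       ()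
next²-no-fixpoint (suc (suc zero)) ()

next²≢next : ∀ x → next (next x) ≢ next x
next²≢next = next-no-fixpoint ∘ next

non-descent : (τ : Fin 3 → ℕ) → ∃ λ x → τ x ≤ τ (next x)
non-descent τ with ≤-total (τ zero) (τ (suc zero))
... | inj₁ τ₀≤τ₁ = zero , τ₀≤τ₁
... | inj₂ τ₁≤τ₀ with ≤-total (τ (suc zero)) (τ (suc (suc zero)))
...   | inj₁ τ₁≤τ₂ = suc zero , τ₁≤τ₂
...   | inj₂ τ₂≤τ₁ = suc (suc zero) , ≤-trans τ₂≤τ₁ τ₁≤τ₀

triangle-labels : Fin 3 → Fin 3 → List ℕ
triangle-labels u v with v ≟ next u
... | yes _ = [ 1 ]
... | no  _ = []

triangle-noLoops : ∀ u → triangle-labels u u ≡ []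
triangle-noLoops u with u ≟ next u
... | yes u≡next-u = contradiction (sym u≡next-u) (next-no-fixpoint u)
... | no  _        = refl

triangle : DTG 3
triangle = record { labels = triangle-labels ; noLoops = triangle-noLoops }

triangle-simple : Simple triangle
triangle-simple u v with v ≟ next u
... | yes _ = s≤s z≤n
... | no  _ = z≤n

∈-triangle-labels : ∀ {u v t} → t ∈ triangle-labels u v → v ≡ next u × t ≡ 1
∈-triangle-labels {u} {v} p with v ≟ next u
∈-triangle-labels (here t≡1) | yes v≡next-u = v≡next-u , t≡1

triangle-arc : ∀ u → 1 ∈ triangle-labels u (next u)
triangle-arc u with next u ≟ next u
... | yes _  = here refl
... | no  ≢-refl = contradiction refl ≢-refl

StrictReach-triangle : ∀ {u v} → StrictReach triangle u v ⇔ v ≡ next u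
StrictReach-triangle = mk⇔ reach⇒next λ { refl → arc⇒reach triangle (triangle-arc _) }
  where
  reach⇒next : ∀ {u v} → StrictReach triangle u v → v ≡ next u
  reach⇒next (_ , _ , _ , walk , _) =
    proj₁ (∈-triangle-labels
      (constant-labels⇒strict-walk-is-arc triangle (proj₂ ∘ ∈-triangle-labels) walk))

NonStrictReach-not-3-cycle : ∀ {n} (H : DTG n) (s : Fin 3 → Fin n) → Injective _≡_ _≡_ s →
  ¬ (∀ x w → NonStrictReach H (s x) w ⇔ w ≡ s (next x))
NonStrictReach-not-3-cycle H s s-injective cycle =
  next²≢next x (reach⇒next (two-arcs⇒NonStrictReach H s-x≢s-next²-x
    (proj₂ (arc x)) (proj₂ (arc (next x))) label-x≤label-next-x))
  where
  reach⇒next : ∀ {u v} → NonStrictReach H (s u) (s v) → v ≡ next u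
  reach⇒next = s-injective ∘ Equivalence.to (cycle _ _)

  arc : ∀ u → ∃ λ t → t ∈ labels H (s u) (s (next u))
  arc u = reach-sole-successor⇒arc H (Equivalence.to (cycle u _))
            (proj₂ (Equivalence.from (cycle u _) refl))

  label : Fin 3 → ℕ
  label = proj₁ ∘ arc

  x : Fin 3
  x = proj₁ (non-descent label)

  label-x≤label-next-x : label x ≤ label (next x)
  label-x≤label-next-x = proj₂ (non-descent label)

  s-x≢s-next²-x : s x ≢ s (next (next x))
  s-x≢s-next²-x = next²-no-fixpoint x ∘ sym ∘ s-injective

Isomorphic-transports-successor : ∀ {n} {R S : Fin n → Fin n → Set} {f : Fin n → Fin n} →
  (∀ {u v} → R u v ⇔ v ≡ f u) → ((σ , _) : Isomorphic R S) →
  ∀ u w → S (Inverse.to σ u) w ⇔ w ≡ Inverse.to σ (f u)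
Isomorphic-transports-successor {S = S} {f} R⇔f (σ , R⇔S) u w = mk⇔ S⇒f f⇒S
  where
  open Inverse σ using (to; from; strictlyInverseˡ)

  S⇒f : S (to u) w → w ≡ to (f u)
  S⇒f r = begin
    w             ≡⟨ strictlyInverseˡ w ⟨
    to (from w)   ≡⟨ cong to (Equivalence.to R⇔f (Equivalence.from (R⇔S u (from w)) r′)) ⟩
    to (f u)      ∎
    where r′ = subst (S (to u)) (sym (strictlyInverseˡ w)) r

  f⇒S : w ≡ to (f u) → S (to u) w
  f⇒S refl = Equivalence.to (R⇔S u (f u)) (Equivalence.from R⇔f refl)

lemma8 : Σ ℕ λ n → Σ (DTG n) λ G →
    Simple G × ((H : DTG n) → ¬ Isomorphic (StrictReach G) (NonStrictReach H))
lemma8 = 3 , triangle , triangle-simple , λ H iso@(σ , _) →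
  NonStrictReach-not-3-cycle H (Inverse.to σ) (Injection.injective (↔⇒↣ σ))
    (Isomorphic-transports-successor {S = NonStrictReach H} StrictReach-triangle iso)
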